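{- Let $\Gamma\subseteq\mathcal{A}$ and let $Y_1,Y_2\subseteq St$ be fixed. The function $solve_{op}(Y_1,\mathcal{V}_M)$ for a unary operator $op$ and $solve_{op}(Y_1,Y_2,\mathcal{V}_M)$ for a binary operator $op$ is (i) positive monotonic w.r.t. $VB$ for $op\in\{\wedge,\langle\langle\Gamma\rangle\rangle\mathrm{X},\langle\langle\Gamma\rangle\rangle\mathrm{G},\langle\langle\Gamma\rangle\rangle\mathrm{U}\}$; (ii) negative monotonic w.r.t. $VB$ for $op=\neg$; (iii) positive and negative monotonic w.r.t. $TB_i$ for $i\in\mathcal{A}$ and $op\in\{\neg,\wedge\}$; (iv) positive monotonic w.r.t. $TB_i$ for $i\in\Gamma$ and $op\in\{\langle\langle\Gamma\rangle\rangle\mathrm{X},\langle\langle\Gamma\rangle\rangle\mathrm{G},\langle\langle\Gamma\rangle\rangle\mathrm{U}\}$; (v) negative monotonic w.r.t. $TB_i$ for $i\in\mathcal{A}\setminus\Gamma$ and $op\in\{\langle\langle\Gamma\rangle\rangle\mathrm{X},\langle\langle\Gamma\rangle\rangle\mathrm{G},\langle\langle\Gamma\rangle\rangle\mathrm{U}\}$.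
   Context: Fix a set of agents $\mathcal{A}=\{1,\dots,n\}$, a finite set $\mathcal{PV}$ of propositional variables, and for each agent $i$ a finite set of local states $L_i=\{l_i^1,\dots,l_i^{n_i}\}$. Agent $i$ has actions $Act_i=\{a_i^1,\dots,a_i^{n_i}\}$ and a local protocol $P_i:L_i\to 2^{Act_i}$ with $P_i(l)\neq\emptyset$ for all $l$; its local transition function is $T_i(l_i^k,a_i^j)=l_i^j$, defined iff $a_i^j\in P_i(l_i^k)$. A model is $M=(St,T,V)$ with $St=L_1\times\dots\times L_n$, global actions $Act=Act_1\times\dots\times Act_n$, global transition $T(g,a)=g'$ iff $T_i(g^i,a^i)=g'^i$ for all $i$, and valuation $V:St\to 2^{\mathcal{PV}}$. Encoding: $P_i$ is a Boolean $n_i\times n_i$ table (entry $(l,a)$ is $1$ iff $a\in P_i(l)$) flattened into $tb_i$; $V$ is a bit vector $vb$ of length $|St|\cdot|\mathcal{PV}|$ (entry $(g,p)$ is $1$ iff $p\in V(g)$). The model is encoded by $v_M=(tb_1,\dots,tb_n,vb)$; $\mathcal{V}_M=(TB_1,\dots,TB_n,VB)$ is the corresponding vector of Boolean variables; only vectors encoding models (each local state has at least one available action) are considered. A path from $g$ is $g_0a_0g_1a_1\dots$ with $g_0=g$, $T(g_k,a_k)=g_{k+1}$; $\pi[k]=g_k$. A strategy of agent $i$ is $\sigma_i:St\to Act_i$ with $\sigma_i(g)\in P_i(g^i)$; a joint strategy $\sigma_\Gamma$ is a tuple of strategies of agents in $\Gamma$; $out_M(g,\sigma_\Gamma)$ is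 the set of paths from $g$ with $a_k^j=\sigma_j(g_k)$ for all $k$ and $j\in\Gamma$. For the model $M$ encoded by $v_M$ and $Y,Y_1,Y_2\subseteq St$: $solve_\neg(Y,v_M)=St\setminus Y$; $solve_\wedge(Y_1,Y_2,v_M)=Y_1\cap Y_2$; $solve_{\langle\langle\Gamma\rangle\rangle\mathrm{X}}(Y,v_M)$ is the set of $g$ such that some $\sigma_\Gamma$ has $out_M(g,\sigma_\Gamma)\neq\emptyset$ and $\pi[1]\in Y$ for all $\pi$ in it; $solve_{\langle\langle\Gamma\rangle\rangle\mathrm{G}}(Y,v_M)$ is the set of $g$ such that some $\sigma_\Gamma$ has nonempty outcome and $\pi[k]\in Y$ for all $k\ge0$ and all $\pi$ in it; $solve_{\langle\langle\Gamma\rangle\rangle\mathrm{U}}(Y_1,Y_2,v_M)$ is the set of $g$ such that some $\sigma_\Gamma$ has nonempty outcome and every $\pi$ in it has $k\ge0$ with $\pi[k]\in Y_2$ and $\pi[j]\in Y_1$ for $j<k$. A set-valued function $F$ of bit vectors is positive (resp. negative) monotonic w.r.t. a set $W$ of its variables if changing any single variable of $W$ from $0$ to $1$ (resp. from $1$ to $0$), others fixed, yields a value $\supseteq$ the original value. -}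

module Defs where

open import Data.Nat using (ℕ; zero; suc; _<_)
open import Data.Fin using (Fin)
open import Data.Bool using (Bool; true; false)
open import Data.Product using (Σ; ∃; _×_; _,_)
open import Data.Fin.Subset using (Subset; _∈_; _∉_)
open import Relation.Binary.PropositionalEquality using (_≡_; _≢_)
open import Relation.Nullary using (¬_)

-- Parameters: n agents (Fin n), agent i has ns i local states
-- l_i^1..l_i^{ns i} (represented by Fin (ns i)) and equally many actions
-- a_i^1..a_i^{ns i} (also Fin (ns i)); np propositional variables (Fin np).

module _ {n : ℕ} (ns : Fin n → ℕ) where

  St : Set
  St = (i : Fin n) → Fin (ns i)

  Act : Set
  Act = (i : Fin n) → Fin (ns i)

  Pred : Set₁
  Pred = St → Set

module _ {n : ℕ} {ns : Fin n → ℕ} where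

  _⊆ₛ_ : Pred ns → Pred ns → Set
  Y ⊆ₛ Z = ∀ g → Y g → Z g

-- Encoding v_M = (tb_1, ..., tb_n, vb).
-- TB i l a = entry (l, a) of the protocol table of agent i (true iff a ∈ P_i(l)).
-- VB g p   = entry (g, p) of the valuation bit vector (true iff p ∈ V(g)).
record Enc {n : ℕ} (ns : Fin n → ℕ) (np : ℕ) : Set where
  field
    TB : (i : Fin n) → Fin (ns i) → Fin (ns i) → Bool
    VB : St ns → Fin np → Bool
open Enc public

module _ {n : ℕ} {ns : Fin n → ℕ} {np : ℕ} where

  -- the vector encodes a model: every local state has an available action
  Valid : Enc ns np → Set
  Valid e = ∀ i (l : Fin (ns i)) → ∃ λ (a : Fin (ns i)) → TB e i l a ≡ true

  -- Since T_i(l_i^k, a_i^j) = l_i^j, the global successor T(g, a) is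
  -- the state whose i-th component is the index of a^i, i.e. a itself.
  pst : St ns → (ℕ → Act ns) → ℕ → St ns
  pst g acts zero    = g
  pst g acts (suc k) = acts k

  record Path (e : Enc ns np) (g : St ns) : Set where
    field
      acts : ℕ → Act ns
      enabled : ∀ k j → TB e j (pst g acts k j) (acts k j) ≡ true
  open Path public

  _[_] : ∀ {e g} → Path e g → ℕ → St ns
  _[_] {g = g} π k = pst g (acts π) k

  record JStrat (e : Enc ns np) (Γ : Subset n) : Set where
    field
      σ : (i : Fin n) → i ∈ Γ → St ns → Fin (ns i)
      σ-ok : ∀ i (p : i ∈ Γ) (g : St ns) → TB e i (g i) (σ i p g) ≡ true
  open JStrat public

  Out : ∀ {e Γ g} → JStrat e Γ → Path e g → Set
  Out {Γ = Γ} s π = ∀ k j (p : j ∈ Γ) → acts π k j ≡ σ s j p (π [ k ])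

  solve¬ : Pred ns → Enc ns np → Pred ns
  solve¬ Y e g = ¬ Y g

  solve∧ : Pred ns → Pred ns → Enc ns np → Pred ns
  solve∧ Y₁ Y₂ e g = Y₁ g × Y₂ g

  solveX : Subset n → Pred ns → Enc ns np → Pred ns
  solveX Γ Y e g = Σ (JStrat e Γ) λ s →
    (∃ λ (π : Path e g) → Out s π) ×
    (∀ (π : Path e g) → Out s π → Y (π [ 1 ]))

  solveG : Subset n → Pred ns → Enc ns np → Pred ns
  solveG Γ Y e g = Σ (JStrat e Γ) λ s →
    (∃ λ (π : Path e g) → Out s π) ×
    (∀ (π : Path e g) → Out s π → ∀ k → Y (π [ k ]))

  solveU : Subset n → Pred ns → Pred ns → Enc ns np → Pred ns
  solveU Γ Y₁ Y₂ e g = Σ (JStrat e Γ) λ s →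
    (∃ λ (π : Path e g) → Out s π) ×
    (∀ (π : Path e g) → Out s π →
       ∃ λ k → Y₂ (π [ k ]) × (∀ j → j < k → Y₁ (π [ j ])))

  TBUp : Fin n → Enc ns np → Enc ns np → Set
  TBUp i e e' = Σ (Fin (ns i)) λ l → Σ (Fin (ns i)) λ a →
    TB e i l a ≡ false × TB e' i l a ≡ true ×
    (∀ l' a' → ¬ (l' ≡ l × a' ≡ a) → TB e' i l' a' ≡ TB e i l' a') ×
    (∀ j → j ≢ i → ∀ l' a' → TB e' j l' a' ≡ TB e j l' a') ×
    (∀ g p → VB e' g p ≡ VB e g p)

  VBUp : Enc ns np → Enc ns np → Set
  VBUp e e' = Σ (St ns) λ g → Σ (Fin np) λ p →
    VB e g p ≡ false × VB e' g p ≡ true ×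
    (∀ g' p' → ¬ ((∀ j → g' j ≡ g j) × p' ≡ p) → VB e' g' p' ≡ VB e g' p') ×
    (∀ j l a → TB e' j l a ≡ TB e j l a)

  -- monotonicity of F w.r.t. a set of variables, given by the
  -- "single 0→1 change" relation Up; only encodings of models considered
  PosMono : (Enc ns np → Enc ns np → Set) → (Enc ns np → Pred ns) → Set
  PosMono Up F = ∀ e e' → Valid e → Valid e' → Up e e' → F e ⊆ₛ F e'

  NegMono : (Enc ns np → Enc ns np → Set) → (Enc ns np → Pred ns) → Set
  NegMono Up F = ∀ e e' → Valid e → Valid e' → Up e' e → F e ⊆ₛ F e'

-- Y₁ and Y₂ do not depend on the encoding, so ¬ and ∧ are constant in it, and
-- flipping a valuation bit leaves the protocols untouched. A strategic operator
-- ⟨⟨Γ⟩⟩φ survives any change that enlarges the coalition's protocols and shrinks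
-- the opponents': the coalition keeps its strategy, every new outcome is an old
-- outcome, and in a model where each local state has an action every strategy
-- has an outcome. Setting a bit of TB_i is such a change when i ∈ Γ, and
-- clearing it is one when i ∉ Γ.
module Submission where

open import Defs
open import Data.Nat using (ℕ; zero; suc; _<_)
open import Data.Fin using (Fin)
open import Data.Fin.Subset using (Subset; _∈_; _∉_)
open import Data.Fin.Subset.Properties using (_∈?_)
open import Data.Fin.Properties using (_≟_)
open import Data.Bool using (true)
open import Data.Product using (Σ; ∃; _×_; _,_; proj₁; proj₂)
open import Data.Vec.Properties.WithK using ([]=-irrelevant)
open import Function using (flip)
open import Relation.Binary.PropositionalEquality using (_≡_; _≢_; refl; sym; trans; cong; subst)
open import Relation.Nullary using (yes; no)
open import Data.Empty using (⊥-elim)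

module _ {n : ℕ} {ns : Fin n → ℕ} {np : ℕ} where

  Enabled : Enc ns np → (j : Fin n) → Fin (ns j) → Fin (ns j) → Set
  Enabled e j l a = TB e j l a ≡ true

  _⊑_on_ : Enc ns np → Enc ns np → (Fin n → Set) → Set
  e ⊑ e' on P = ∀ j → P j → ∀ l a → Enabled e j l a → Enabled e' j l a

  -- ⟨⟨Γ⟩⟩Φ for a property Φ of the sequence of visited states; X, G and U are instances
  Achieves : Subset n → ((ℕ → St ns) → Set) → Enc ns np → Pred ns
  Achieves Γ Φ e g = Σ (JStrat e Γ) λ s →
    (∃ λ (π : Path e g) → Out s π) × (∀ (π : Path e g) → Out s π → Φ (π [_]))

  constant-mono : ∀ {R} {F : Pred ns} → PosMono R (λ (_ : Enc ns np) → F)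
  constant-mono _ _ _ _ _ _ x = x

  VBUp⇒⊑ : ∀ {e e' P Q} → VBUp e e' → e ⊑ e' on P × e' ⊑ e on Q
  VBUp⇒⊑ (_ , _ , _ , _ , _ , sameTB) =
    (λ j _ l a → trans (sameTB j l a)) , (λ j _ l a → trans (sym (sameTB j l a)))

  TBUp⇒⊑ : ∀ {i e e' P} → TBUp i e e' → e ⊑ e' on P
  TBUp⇒⊑ {i} (l₀ , a₀ , _ , set , sameᵢ , sameⱼ , _) j _ l a en with j ≟ i
  ... | no j≢i = trans (sameⱼ j j≢i l a) en
  ... | yes refl with l ≟ l₀ | a ≟ a₀
  ...   | yes refl | yes refl = set
  ...   | no l≢l₀  | _        = trans (sameᵢ l a (λ (l≡l₀ , _) → l≢l₀ l≡l₀)) en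
  ...   | yes _    | no a≢a₀  = trans (sameᵢ l a (λ (_ , a≡a₀) → a≢a₀ a≡a₀)) en

  TBUp⇒⊒-elsewhere : ∀ {i e e' P} → TBUp i e e' → (∀ j → P j → j ≢ i) → e' ⊑ e on P
  TBUp⇒⊒-elsewhere (_ , _ , _ , _ , _ , sameⱼ , _) elsewhere j Pj l a =
    trans (sym (sameⱼ j (elsewhere j Pj) l a))

  module _ {Γ : Subset n} where

    transport-strategy : ∀ {e e'} → e ⊑ e' on (_∈ Γ) → JStrat e Γ → JStrat e' Γ
    transport-strategy incl s = record
      { σ = σ s ; σ-ok = λ j j∈Γ h → incl j j∈Γ _ _ (σ-ok s j j∈Γ h) }

    outcome-pullback : ∀ {e e' g} (incl : e ⊑ e' on (_∈ Γ)) → e' ⊑ e on (_∉ Γ) →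
      (s : JStrat e Γ) (π : Path e' g) → Out (transport-strategy incl s) π →
      Σ (Path e g) λ π₀ → acts π₀ ≡ acts π
    outcome-pullback {e} _ shrink s π follows = record { acts = acts π ; enabled = en } , refl
      where
      en : ∀ k j → Enabled e j ((π [ k ]) j) (acts π k j)
      en k j with j ∈? Γ
      ... | yes j∈Γ = subst (Enabled e j _) (sym (follows k j j∈Γ)) (σ-ok s j j∈Γ (π [ k ]))
      ... | no  j∉Γ = shrink j j∉Γ _ _ (enabled π k j)

    outcome-nonempty : ∀ {e} → Valid e → (s : JStrat e Γ) (g : St ns) → ∃ λ (π : Path e g) → Out s π
    outcome-nonempty {e} valid s g = record { acts = acts' ; enabled = en } , follows
      where
      next : St ns → Act ns
      next h j with j ∈? Γ
      ... | yes j∈Γ = σ s j j∈Γ h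
      ... | no  _   = proj₁ (valid j (h j))

      next-enabled : ∀ h j → Enabled e j (h j) (next h j)
      next-enabled h j with j ∈? Γ
      ... | yes j∈Γ = σ-ok s j j∈Γ h
      ... | no  _   = proj₂ (valid j (h j))

      next-follows : ∀ h j (j∈Γ : j ∈ Γ) → next h j ≡ σ s j j∈Γ h
      next-follows h j j∈Γ with j ∈? Γ
      ... | yes j∈Γ' = cong (λ p → σ s j p h) ([]=-irrelevant j∈Γ' j∈Γ)
      ... | no  j∉Γ  = ⊥-elim (j∉Γ j∈Γ)

      state : ℕ → St ns
      state zero    = g
      state (suc k) = next (state k)

      acts' : ℕ → Act ns
      acts' k = state (suc k)

      en : ∀ k j → Enabled e j (pst {np = np} g acts' k j) (acts' k j)
      en zero    = next-enabled g
      en (suc k) = next-enabled (state (suc k))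

      follows : ∀ k j (j∈Γ : j ∈ Γ) → acts' k j ≡ σ s j j∈Γ (pst {np = np} g acts' k)
      follows zero    = next-follows g
      follows (suc k) = next-follows (state (suc k))

    achieves-mono : ∀ Φ {e e'} → Valid e' → e ⊑ e' on (_∈ Γ) → e' ⊑ e on (_∉ Γ) →
      Achieves Γ Φ e ⊆ₛ Achieves Γ Φ e'
    achieves-mono Φ {e' = e'} valid grow shrink g (s , _ , wins) =
      s' , outcome-nonempty valid s' g , wins'
      where
      s' : JStrat e' Γ
      s' = transport-strategy grow s

      wins' : ∀ π → Out s' π → Φ (π [_])
      wins' π follows with outcome-pullback grow shrink s π follows
      ... | π₀ , refl = wins π₀ follows

  strategic-mono : ∀ {R} Γ (Y₁ Y₂ : Pred ns) →
    (∀ {e e'} → R e e' → e ⊑ e' on (_∈ Γ) × e' ⊑ e on (_∉ Γ)) →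
    PosMono R (solveX Γ Y₁) × PosMono R (solveG Γ Y₁) × PosMono R (solveU Γ Y₁ Y₂)
  strategic-mono {R} Γ Y₁ Y₂ change =
      lift (λ ρ → Y₁ (ρ 1))
    , lift (λ ρ → ∀ k → Y₁ (ρ k))
    , lift (λ ρ → ∃ λ k → Y₂ (ρ k) × (∀ j → j < k → Y₁ (ρ j)))
    where
    lift : ∀ Φ → PosMono R (Achieves Γ Φ)
    lift Φ _ _ _ valid r = achieves-mono Φ valid (proj₁ (change r)) (proj₂ (change r))

theorem3p9 : ∀ {n : ℕ} (ns : Fin n → ℕ) (np : ℕ) (Γ : Subset n) (Y₁ Y₂ : Pred ns) →
    -- (i)
    (PosMono {np = np} VBUp (solve∧ Y₁ Y₂) ×
     PosMono {np = np} VBUp (solveX Γ Y₁) ×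
     PosMono {np = np} VBUp (solveG Γ Y₁) ×
     PosMono {np = np} VBUp (solveU Γ Y₁ Y₂)) ×
    -- (ii)
    NegMono {np = np} VBUp (solve¬ Y₁) ×
    -- (iii)
    (∀ i → PosMono {np = np} (TBUp i) (solve¬ Y₁) × NegMono {np = np} (TBUp i) (solve¬ Y₁) ×
           PosMono {np = np} (TBUp i) (solve∧ Y₁ Y₂) × NegMono {np = np} (TBUp i) (solve∧ Y₁ Y₂)) ×
    -- (iv)
    (∀ i → i ∈ Γ →
       PosMono {np = np} (TBUp i) (solveX Γ Y₁) ×
       PosMono {np = np} (TBUp i) (solveG Γ Y₁) ×
       PosMono {np = np} (TBUp i) (solveU Γ Y₁ Y₂)) ×
    -- (v)
    (∀ i → i ∉ Γ →
       NegMono {np = np} (TBUp i) (solveX Γ Y₁) ×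
       NegMono {np = np} (TBUp i) (solveG Γ Y₁) ×
       NegMono {np = np} (TBUp i) (solveU Γ Y₁ Y₂))
theorem3p9 ns np Γ Y₁ Y₂ =
    (constant-mono , strategic-mono Γ Y₁ Y₂ VBUp⇒⊑)
  , constant-mono
  , (λ _ → constant-mono , constant-mono , constant-mono , constant-mono)
  , (λ i i∈Γ → strategic-mono Γ Y₁ Y₂ λ r →
       TBUp⇒⊑ r , TBUp⇒⊒-elsewhere r λ { j j∉Γ refl → j∉Γ i∈Γ })
  , (λ i i∉Γ → strategic-mono {R = flip (TBUp i)} Γ Y₁ Y₂ λ r →
       TBUp⇒⊒-elsewhere r (λ { j j∈Γ refl → i∉Γ j∈Γ }) , TBUp⇒⊑ r)
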